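{- Let $G$ be a finite simple graph that has a perfect matching and let $M$ be a perfect matching of $G$. Then for each $v \in V_{SD}(G)$ there exists an $M$-$mm$-alternating closed walk starting (and ending) at $v$.
   Context: A walk is $M$-alternating if, for each pair of consecutive edges, exactly one belongs to $M$; it is $M$-$mm$-alternating if moreover its first and last edges belong to $M$. An $M$-blossom is an odd cycle of length $2k+1$ containing exactly $k$ edges of $M$; its base is the unique vertex of the cycle not matched by $M$ to another vertex of the cycle. An $M$-Jposy is a configuration consisting of two, not necessarily distinct, $M$-blossoms joined by an odd-length $M$-alternating walk (starting and ending with edges of $M$) whose endpoints are the bases of the two blossoms. For a graph with a perfect matching, $V_{SD}(G)$ is the set of vertices of $G$ that lie on an $M'$-Jposy for some perfect matching $M'$ of $G$. -}

module Defs where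

open import Data.Nat using (ℕ; zero; suc; _+_; _*_; _<_; _≤_; _∸_)
open import Data.Fin using (Fin; _≟_)
open import Data.Product using (Σ; ∃; ∃-syntax; _×_; _,_)
open import Data.Sum using (_⊎_)
open import Relation.Nullary using (¬_; yes; no)
open import Relation.Binary.PropositionalEquality using (_≡_; _≢_)

record Graph (n : ℕ) : Set₁ where
  field
    Adj    : Fin n → Fin n → Set
    sym    : ∀ {u v} → Adj u v → Adj v u
    irrefl : ∀ {u} → ¬ Adj u u
open Graph public

record PerfectMatching {n : ℕ} (G : Graph n) : Set where
  field
    mate       : Fin n → Fin n
    mate-adj   : ∀ v → Adj G v (mate v)
    mate-invol : ∀ v → mate (mate v) ≡ v
open PerfectMatching public

InM : ∀ {n} {G : Graph n} → PerfectMatching G → Fin n → Fin n → Set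
InM M u v = mate M u ≡ v

-- A walk of length k: vertices w 0, w 1, ..., w k (values beyond k are irrelevant),
-- with consecutive vertices adjacent. Edge i is {w i, w (suc i)}, for i < k.
IsWalk : ∀ {n} → Graph n → (ℕ → Fin n) → ℕ → Set
IsWalk G w k = ∀ i → i < k → Adj G (w i) (w (suc i))

ExactlyOne : Set → Set → Set
ExactlyOne P Q = (P × ¬ Q) ⊎ (¬ P × Q)

IsAltWalk : ∀ {n} {G : Graph n} → PerfectMatching G → (ℕ → Fin n) → ℕ → Set
IsAltWalk {G = G} M w k =
  IsWalk G w k ×
  (∀ i → suc i < k →
     ExactlyOne (InM M (w i) (w (suc i))) (InM M (w (suc i)) (w (suc (suc i)))))

IsMMAltWalk : ∀ {n} {G : Graph n} → PerfectMatching G → (ℕ → Fin n) → ℕ → Set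
IsMMAltWalk M w k =
  IsAltWalk M w k × 1 ≤ k × InM M (w 0) (w 1) × InM M (w (k ∸ 1)) (w k)

countM : ∀ {n} {G : Graph n} → PerfectMatching G → (ℕ → Fin n) → ℕ → ℕ
countM M c zero = zero
countM M c (suc m) with mate M (c m) ≟ c (suc m)
... | yes _ = suc (countM M c m)
... | no  _ = countM M c m

IsOddCycle : ∀ {n} → Graph n → (ℕ → Fin n) → ℕ → Set
IsOddCycle G c k =
  1 ≤ k ×
  IsWalk G c (suc (2 * k)) ×
  c (suc (2 * k)) ≡ c 0 ×
  (∀ i j → i < j → j ≤ 2 * k → c i ≢ c j)

IsBlossom : ∀ {n} {G : Graph n} → PerfectMatching G → (ℕ → Fin n) → ℕ → Set
IsBlossom {G = G} M c k = IsOddCycle G c k × countM M c (suc (2 * k)) ≡ k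

OnCycle : ∀ {n} → (ℕ → Fin n) → ℕ → Fin n → Set
OnCycle c k v = ∃[ i ] (i ≤ 2 * k × c i ≡ v)

IsBase : ∀ {n} {G : Graph n} → PerfectMatching G → (ℕ → Fin n) → ℕ → Fin n → Set
IsBase M c k b = OnCycle c k b × ¬ OnCycle c k (mate M b)

OnWalk : ∀ {n} → (ℕ → Fin n) → ℕ → Fin n → Set
OnWalk w k v = ∃[ i ] (i ≤ k × w i ≡ v)

record Jposy {n : ℕ} {G : Graph n} (M : PerfectMatching G) : Set where
  field
    c₁ : ℕ → Fin n
    k₁ : ℕ
    c₂ : ℕ → Fin n
    k₂ : ℕ
    b₁ : Fin n
    b₂ : Fin n
    w  : ℕ → Fin n
    ℓ  : ℕ
    blossom₁ : IsBlossom M c₁ k₁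
    blossom₂ : IsBlossom M c₂ k₂
    base₁    : IsBase M c₁ k₁ b₁
    base₂    : IsBase M c₂ k₂ b₂
    walk     : IsMMAltWalk M w ℓ
    odd      : ∃[ m ] ℓ ≡ suc (2 * m)
    start    : w 0 ≡ b₁
    end      : w ℓ ≡ b₂

OnJposy : ∀ {n} {G : Graph n} {M : PerfectMatching G} → Jposy M → Fin n → Set
OnJposy J v = OnCycle (Jposy.c₁ J) (Jposy.k₁ J) v
            ⊎ OnCycle (Jposy.c₂ J) (Jposy.k₂ J) v
            ⊎ OnWalk (Jposy.w J) (Jposy.ℓ J) v

InVSD : ∀ {n} → Graph n → Fin n → Set
InVSD G v = Σ (PerfectMatching G) λ M' → Σ (Jposy M') λ J → OnJposy J v

-- For the matching M′ of the Jposy, a closed mm-alternating walk at v goes from v to the base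
-- of a blossom, once around the blossom, and back.  Going around works because both blossom
-- edges at the base are unmatched; as no two adjacent blossom edges are matched, having k
-- matched edges out of 2k+1 then forces the blossom to alternate.
--
-- To pass from M′ to M, lift to the bipartite double cover, whose vertices record the parity
-- of a position.  After shortcutting, the closed M′-walk becomes an alternating path from
-- (v, true) to (v, false).  Switching the lifted M′ along this path and joining its two ends
-- gives a second perfect matching ν of the cover.  The ν/M-alternating cycle through
-- (v, true) then contains a path to (v, false) starting and ending with lifted M-edges; its
-- projection is the required closed walk.

module Submission where

open import Defs hiding (sym)

open import Data.Bool as Bool using (Bool; true; false; not)
open import Data.Bool.Properties using (not-involutive; not-injective)
open import Data.Empty using (⊥-elim)
open import Data.Fin as Fin using (Fin)
import Data.Fin.Properties as Fin
import Data.Nat as ℕ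
open import Data.Nat using (ℕ; zero; suc; _+_; _*_; _∸_; _≤_; _<_; z≤n; s≤s; z<s; _≤?_; _<?_)
open import Data.Nat.Induction using (<-rec)
open import Data.Nat.Properties
open import Data.Product using (Σ; ∃; ∃-syntax; _×_; _,_; proj₁; proj₂)
open import Data.Product.Properties using (≡-dec)
open import Data.Sum using (_⊎_; inj₁; inj₂)
open import Function using (case_of_)
open import Relation.Binary.Definitions using (DecidableEquality; tri<; tri≈; tri>)
open import Relation.Binary.PropositionalEquality
open import Relation.Nullary using (¬_; Dec; yes; no)
open import Relation.Nullary.Decidable using (isYes; map′; _×-dec_)
open import Relation.Unary using (Decidable)

alternate : Bool → ℕ → Bool
alternate b zero    = b
alternate b (suc i) = not (alternate b i)

alternate-not : ∀ b i → alternate (not b) i ≡ not (alternate b i)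
alternate-not b zero    = refl
alternate-not b (suc i) = cong not (alternate-not b i)

alternate-+ : ∀ b i j → alternate b (i + j) ≡ alternate (alternate b i) j
alternate-+ b zero    j = refl
alternate-+ b (suc i) j = begin
  not (alternate b (i + j))           ≡⟨ cong not (alternate-+ b i j) ⟩
  not (alternate (alternate b i) j)   ≡⟨ alternate-not (alternate b i) j ⟨
  alternate (not (alternate b i)) j   ∎
  where open ≡-Reasoning

alternate-alternate : ∀ b i → alternate (alternate b i) i ≡ b
alternate-alternate b zero    = refl
alternate-alternate b (suc i) = begin
  not (alternate (not (alternate b i)) i)        ≡⟨ cong not (alternate-not (alternate b i) i) ⟩
  not (not (alternate (alternate b i) i))        ≡⟨ not-involutive _ ⟩
  alternate (alternate b i) i                    ≡⟨ alternate-alternate b i ⟩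
  b                                              ∎
  where open ≡-Reasoning

alternate-+-self : ∀ b i → alternate b (i + i) ≡ b
alternate-+-self b i = trans (alternate-+ b i i) (alternate-alternate b i)

alternate-2* : ∀ b i → alternate b (2 * i) ≡ b
alternate-2* b i = trans (cong (λ j → alternate b (i + j)) (+-identityʳ i)) (alternate-+-self b i)

splice : {A : Set} → (ℕ → A) → ℕ → (ℕ → A) → ℕ → A
splice f L g i with i ≤? L
... | yes _ = f i
... | no  _ = g (i ∸ L)

splice-≤ : ∀ {A : Set} (f : ℕ → A) L g {i} → i ≤ L → splice f L g i ≡ f i
splice-≤ f L g {i} i≤L with i ≤? L
... | yes _   = refl
... | no  i≰L = ⊥-elim (i≰L i≤L)

splice-+ : ∀ {A : Set} (f : ℕ → A) L g → f L ≡ g 0 → ∀ k → splice f L g (L + k) ≡ g k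
splice-+ f L g fL≡g0 k with L + k ≤? L
... | no  _ = cong g (m+n∸m≡n L k)
... | yes L+k≤L with k
...   | zero   = trans (cong f (+-identityʳ L)) fL≡g0
...   | suc k′ = ⊥-elim (m+1+n≰m L L+k≤L)

-- Alternating walks

module _ {n : ℕ} {G : Graph n} (M : PerfectMatching G) where

  InM-sym : ∀ {x y} → InM M x y → InM M y x
  InM-sym {x} e = trans (cong (mate M) (sym e)) (mate-invol M x)

  InMᵇ : Bool → Fin n → Fin n → Set
  InMᵇ true  x y = InM M x y
  InMᵇ false x y = ¬ InM M x y

  InMᵇ-sym : ∀ b {x y} → InMᵇ b x y → InMᵇ b y x
  InMᵇ-sym true  e   = InM-sym e
  InMᵇ-sym false ¬e  = λ e → ¬e (InM-sym e)

  Step : Bool → Fin n → Fin n → Set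
  Step b x y = Adj G x y × InMᵇ b x y

  Step-sym : ∀ b {x y} → Step b x y → Step b y x
  Step-sym b (xy , kind) = Graph.sym G xy , InMᵇ-sym b kind

  -- Edge i lies in M iff alternate b i; e is the kind an appended edge would need.
  record AltWalk (x y : Fin n) (b e : Bool) : Set where
    field
      vertex : ℕ → Fin n
      length : ℕ
      step   : ∀ i → i < length → Step (alternate b i) (vertex i) (vertex (suc i))
      start  : vertex 0 ≡ x
      end    : vertex length ≡ y
      parity : alternate b length ≡ e

open AltWalk

module _ {n : ℕ} {G : Graph n} {M : PerfectMatching G} where

  edge : ∀ {x y b} → Step M b x y → AltWalk M x y b (not b)
  edge {x} {y} s = record
    { vertex = λ { zero → x ; (suc _) → y } ; length = 1
    ; step = λ { zero _ → s ; (suc _) (s≤s ()) } ; start = refl ; end = refl ; parity = refl }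

  cast : ∀ {x x′ y y′ b e e′} → x ≡ x′ → y ≡ y′ → e ≡ e′ → AltWalk M x y b e → AltWalk M x′ y′ b e′
  cast x≡x′ y≡y′ e≡e′ W = record
    { vertex = vertex W ; length = length W ; step = step W
    ; start = trans (start W) x≡x′ ; end = trans (end W) y≡y′ ; parity = trans (parity W) e≡e′ }

  take : ∀ {x y b e} (W : AltWalk M x y b e) i → i ≤ length W → AltWalk M x (vertex W i) b (alternate b i)
  take W i i≤ = record
    { vertex = vertex W ; length = i ; step = λ j j< → step W j (<-≤-trans j< i≤)
    ; start = start W ; end = refl ; parity = refl }

  drop : ∀ {x y b e} (W : AltWalk M x y b e) i → i ≤ length W → AltWalk M (vertex W i) y (alternate b i) e
  drop {b = b} W i i≤ = record
    { vertex = λ j → vertex W (i + j)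
    ; length = length W ∸ i
    ; step   = λ j j< → subst₂ (λ c z → Step M c (vertex W (i + j)) z)
                          (alternate-+ b i j) (cong (vertex W) (sym (+-suc i j)))
                          (step W (i + j) (subst (i + j <_) i+[L∸i]≡L (+-monoʳ-< i j<)))
    ; start  = cong (vertex W) (+-identityʳ i)
    ; end    = trans (cong (vertex W) i+[L∸i]≡L) (end W)
    ; parity = trans (sym (alternate-+ b i (length W ∸ i))) (trans (cong (alternate b) i+[L∸i]≡L) (parity W)) }
    where
    i+[L∸i]≡L : i + (length W ∸ i) ≡ length W
    i+[L∸i]≡L = m+[n∸m]≡n i≤

  reverse : ∀ {x y b e} → AltWalk M x y b e → AltWalk M y x (not e) (not b)
  reverse {b = b} {e} W = record
    { vertex = λ i → vertex W (L ∸ i)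
    ; length = L
    ; step   = reversed-step
    ; start  = end W
    ; end    = trans (cong (vertex W) (n∸n≡0 L)) (start W)
    ; parity = begin
        alternate (not e) L                  ≡⟨ cong (λ c → alternate (not c) L) (parity W) ⟨
        alternate (not (alternate b L)) L    ≡⟨ alternate-not (alternate b L) L ⟩
        not (alternate (alternate b L) L)    ≡⟨ cong not (alternate-alternate b L) ⟩
        not b                                ∎ }
    where
    open ≡-Reasoning
    L = length W
    reversed-step : ∀ i → i < L → Step M (alternate (not e) i) (vertex W (L ∸ i)) (vertex W (L ∸ suc i))
    reversed-step i i<L = subst₂ (λ c z → Step M c z (vertex W j)) kind (cong (vertex W) (sym L∸i≡1+j))
                            (Step-sym M _ (step W j (∸-monoʳ-< {L} {suc i} {0} z<s i<L)))
      where
      j = L ∸ suc i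
      L∸i≡1+j : L ∸ i ≡ suc j
      L∸i≡1+j = +-∸-assoc 1 i<L
      kind : alternate b j ≡ alternate (not e) i
      kind = begin
        alternate b j                                          ≡⟨ alternate-alternate (alternate b j) i ⟨
        alternate (alternate (alternate b j) i) i              ≡⟨ cong (λ c → alternate c i) (not-involutive _) ⟨
        alternate (not (alternate (alternate b j) (suc i))) i  ≡⟨ cong (λ c → alternate (not c) i) (alternate-+ b j (suc i)) ⟨
        alternate (not (alternate b (j + suc i))) i            ≡⟨ cong (λ m → alternate (not (alternate b m)) i) (m∸n+n≡m i<L) ⟩
        alternate (not (alternate b L)) i                      ≡⟨ cong (λ c → alternate (not c) i) (parity W) ⟩
        alternate (not e) i                                    ∎

  infixr 5 _++_
  _++_ : ∀ {x y z b e f} → AltWalk M x y b e → AltWalk M y z e f → AltWalk M x z b f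
  _++_ {b = b} {e} W₁ W₂ = record
    { vertex = spliced
    ; length = L₁ + length W₂
    ; step   = spliced-step
    ; start  = trans (splice-≤ (vertex W₁) L₁ (vertex W₂) z≤n) (start W₁)
    ; end    = trans (splice-+ (vertex W₁) L₁ (vertex W₂) joint (length W₂)) (end W₂)
    ; parity = trans (alternate-+ b L₁ (length W₂))
                 (trans (cong (λ c → alternate c (length W₂)) (parity W₁)) (parity W₂)) }
    where
    L₁ = length W₁
    spliced = splice (vertex W₁) L₁ (vertex W₂)
    joint : vertex W₁ L₁ ≡ vertex W₂ 0
    joint = trans (end W₁) (sym (start W₂))
    spliced-step : ∀ i → i < L₁ + length W₂ → Step M (alternate b i) (spliced i) (spliced (suc i))
    spliced-step i i< with L₁ ≤? i
    ... | no L₁≰i = let i<L₁ = ≰⇒> L₁≰i in subst₂ (Step M (alternate b i))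
                       (sym (splice-≤ (vertex W₁) L₁ (vertex W₂) (<⇒≤ i<L₁)))
                       (sym (splice-≤ (vertex W₁) L₁ (vertex W₂) i<L₁))
                       (step W₁ i i<L₁)
    ... | yes L₁≤i with k , refl ← m≤n⇒∃[o]m+o≡n L₁≤i =
      subst₂ (λ c z → Step M c (spliced (L₁ + k)) z) kind (cong spliced (+-suc L₁ k))
        (subst₂ (Step M (alternate e k))
          (sym (splice-+ (vertex W₁) L₁ (vertex W₂) joint k))
          (sym (splice-+ (vertex W₁) L₁ (vertex W₂) joint (suc k)))
          (step W₂ k (+-cancelˡ-< L₁ k (length W₂) i<)))
      where
      kind : alternate e k ≡ alternate b (L₁ + k)
      kind = trans (cong (λ c → alternate c k) (sym (parity W₁))) (sym (alternate-+ b L₁ k))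

  InMᵇ-next : ∀ {x y z} c → InMᵇ M c x y → ExactlyOne (InM M x y) (InM M y z) → InMᵇ M (not c) y z
  InMᵇ-next true  _  (inj₁ (_ , ¬yz)) = ¬yz
  InMᵇ-next true  xy (inj₂ (¬xy , _)) = ⊥-elim (¬xy xy)
  InMᵇ-next false ¬xy (inj₁ (xy , _)) = ⊥-elim (¬xy xy)
  InMᵇ-next false _  (inj₂ (_ , yz))  = yz

  InMᵇ-alternating : ∀ {x y z} c → InMᵇ M c x y → InMᵇ M (not c) y z → ExactlyOne (InM M x y) (InM M y z)
  InMᵇ-alternating true  xy ¬yz = inj₁ (xy , ¬yz)
  InMᵇ-alternating false ¬xy yz = inj₂ (¬xy , yz)

  mmAltWalk⇒AltWalk : ∀ {w ℓ} → IsMMAltWalk M w ℓ → ∃[ m ] ℓ ≡ suc (2 * m) →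
                      AltWalk M (w 0) (w ℓ) true false
  mmAltWalk⇒AltWalk {w} {ℓ} ((walk , alternating) , _ , first∈M , _) (m , ℓ≡2m+1) = record
    { vertex = w ; length = ℓ ; step = λ i i< → walk i i< , kind i i<
    ; start = refl ; end = refl
    ; parity = trans (cong (alternate true) ℓ≡2m+1) (cong not (alternate-2* true m)) }
    where
    kind : ∀ i → i < ℓ → InMᵇ M (alternate true i) (w i) (w (suc i))
    kind zero    _    = first∈M
    kind (suc i) 1+i< = InMᵇ-next (alternate true i) (kind i (<-trans (n<1+n i) 1+i<)) (alternating i 1+i<)

  AltWalk⇒mmAltWalk : ∀ {x y} → AltWalk M x y true false →
                      Σ (ℕ → Fin n) λ w → ∃[ k ] (IsMMAltWalk M w k × w 0 ≡ x × w k ≡ y)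
  AltWalk⇒mmAltWalk W with length W | step W | end W | parity W
  ... | zero  | _     | _    | ()
  ... | suc L | step′ | end′ | odd =
    vertex W , suc L , ((walk , alternating) , s≤s z≤n , proj₂ (step′ 0 z<s) , last∈M) , start W , end′
    where
    walk : IsWalk G (vertex W) (suc L)
    walk i i< = proj₁ (step′ i i<)
    alternating : ∀ i → suc i < suc L →
      ExactlyOne (InM M (vertex W i) (vertex W (suc i))) (InM M (vertex W (suc i)) (vertex W (suc (suc i))))
    alternating i 1+i< = InMᵇ-alternating (alternate true i)
                           (proj₂ (step′ i (<-trans (n<1+n i) 1+i<))) (proj₂ (step′ (suc i) 1+i<))
    last∈M : InM M (vertex W L) (vertex W (suc L))
    last∈M = subst (λ c → InMᵇ M c (vertex W L) (vertex W (suc L)))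
               (trans (sym (not-involutive _)) (cong not odd)) (proj₂ (step′ L ≤-refl))

-- Blossoms

bit : Bool → ℕ
bit true  = 1
bit false = 0

count : (ℕ → Bool) → ℕ → ℕ
count f zero    = 0
count f (suc l) = bit (f l) + count f l

count-cong : ∀ {f g} l → (∀ i → i < l → f i ≡ g i) → count f l ≡ count g l
count-cong zero    f≗g = refl
count-cong (suc l) f≗g =
  cong₂ (λ x r → bit x + r) (f≗g l ≤-refl) (count-cong l (λ i i< → f≗g i (m<n⇒m<1+n i<)))

count-+ : ∀ f l₁ l₂ → count f (l₁ + l₂) ≡ count f l₁ + count (λ i → f (l₁ + i)) l₂
count-+ f l₁ zero     = trans (cong (count f) (+-identityʳ l₁)) (sym (+-identityʳ _))
count-+ f l₁ (suc l₂) = begin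
  count f (l₁ + suc l₂)                      ≡⟨ cong (count f) (+-suc l₁ l₂) ⟩
  x + count f (l₁ + l₂)                      ≡⟨ cong (x +_) (count-+ f l₁ l₂) ⟩
  x + (count f l₁ + r)                       ≡⟨ +-assoc x (count f l₁) r ⟨
  (x + count f l₁) + r                       ≡⟨ cong (_+ r) (+-comm x (count f l₁)) ⟩
  (count f l₁ + x) + r                       ≡⟨ +-assoc (count f l₁) x r ⟩
  count f l₁ + (x + r)                       ∎
  where
  open ≡-Reasoning
  x = bit (f (l₁ + l₂))
  r = count (λ i → f (l₁ + i)) l₂

NoAdjacentTrues : (ℕ → Bool) → ℕ → Set
NoAdjacentTrues γ l = ∀ i → suc i < l → γ i ≡ true → γ (suc i) ≡ false

NoAdjacentTrues-≤ : ∀ {γ l l′} → l′ ≤ l → NoAdjacentTrues γ l → NoAdjacentTrues γ l′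
NoAdjacentTrues-≤ l′≤l sparse i 1+i< = sparse i (<-≤-trans 1+i< l′≤l)

private
  bits-≤ : ∀ x y {r s} → (x ≡ true → y ≡ false) → r ≤ s → bit y + (bit x + r) ≤ suc s
  bits-≤ true  true  ¬both _   with ¬both refl
  ... | ()
  bits-≤ true  false _     r≤s = s≤s r≤s
  bits-≤ false true  _     r≤s = s≤s r≤s
  bits-≤ false false _     r≤s = m≤n⇒m≤1+n r≤s

  bits-≡ : ∀ x y {r s} → (x ≡ true → y ≡ false) → r ≤ s → bit y + (bit x + r) ≡ suc s →
           r ≡ s × (x ≡ false → y ≡ true)
  bits-≡ true  true  ¬both _   _ with ¬both refl
  ... | ()
  bits-≡ true  false _     _   eq = suc-injective eq , λ ()
  bits-≡ false true  _     _   eq = suc-injective eq , λ _ → refl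
  bits-≡ false false _     r≤s eq = ⊥-elim (<⇒≱ (s≤s r≤s) (≤-reflexive (sym eq)))

sparse-count-≤ : ∀ m γ → NoAdjacentTrues γ (suc (m + m)) → count γ (suc (m + m)) ≤ suc m
sparse-count-≤ zero    γ _      = bits-≤ false (γ 0) (λ ()) z≤n
sparse-count-≤ (suc m) γ sparse rewrite +-suc m m =
  bits-≤ (γ (suc (m + m))) (γ (suc (suc (m + m)))) (sparse (suc (m + m)) ≤-refl)
    (sparse-count-≤ m γ (NoAdjacentTrues-≤ (n≤1+n _) (NoAdjacentTrues-≤ (n≤1+n _) sparse)))

sparse-count-max : ∀ m γ → NoAdjacentTrues γ (suc (m + m)) → count γ (suc (m + m)) ≡ suc m →
                   ∀ i → i ≤ m + m → γ i ≡ alternate true i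
sparse-count-max zero γ _ total zero _ = only (γ 0) total
  where
  only : ∀ x → bit x + 0 ≡ 1 → x ≡ true
  only true _ = refl
sparse-count-max (suc m) γ sparse total rewrite +-suc m m = γ-pattern
  where
  sparse′ : NoAdjacentTrues γ (suc (m + m))
  sparse′ = NoAdjacentTrues-≤ (n≤1+n _) (NoAdjacentTrues-≤ (n≤1+n _) sparse)
  last-two = bits-≡ (γ (suc (m + m))) (γ (suc (suc (m + m)))) (sparse (suc (m + m)) ≤-refl)
               (sparse-count-≤ m γ sparse′) total
  earlier : ∀ i → i ≤ m + m → γ i ≡ alternate true i
  earlier = sparse-count-max m γ sparse′ (proj₁ last-two)
  alt[2m] : alternate true (m + m) ≡ true
  alt[2m] = alternate-+-self true m
  γ[2m+1] : γ (suc (m + m)) ≡ false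
  γ[2m+1] = sparse (m + m) (n≤1+n _) (trans (earlier (m + m) ≤-refl) alt[2m])
  γ-pattern : ∀ i → i ≤ suc (suc (m + m)) → γ i ≡ alternate true i
  γ-pattern i i≤ with m≤n⇒m<n∨m≡n i≤
  ... | inj₂ refl = trans (proj₂ last-two γ[2m+1]) (cong (λ x → not (not x)) (sym alt[2m]))
  ... | inj₁ (s≤s i≤2m+1) with m≤n⇒m<n∨m≡n i≤2m+1
  ...   | inj₂ refl         = trans γ[2m+1] (cong not (sym alt[2m]))
  ...   | inj₁ (s≤s i≤2m)   = earlier i i≤2m

module _ {n : ℕ} {G : Graph n} (M : PerfectMatching G) where

  matched? : Fin n → Fin n → Bool
  matched? x y = isYes (mate M x Fin.≟ y)

  matchedAt : (ℕ → Fin n) → ℕ → Bool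
  matchedAt c i = matched? (c i) (c (suc i))

  countM≡count : ∀ c l → countM M c l ≡ count (matchedAt c) l
  countM≡count c zero = refl
  countM≡count c (suc l) with mate M (c l) Fin.≟ c (suc l)
  ... | yes _ = cong suc (countM≡count c l)
  ... | no  _ = countM≡count c l

  matchedAt-InMᵇ : ∀ c i b → matchedAt c i ≡ b → InMᵇ M b (c i) (c (suc i))
  matchedAt-InMᵇ c i b eq with mate M (c i) Fin.≟ c (suc i)
  matchedAt-InMᵇ c i true  eq  | yes m = m
  matchedAt-InMᵇ c i false ()  | yes _
  matchedAt-InMᵇ c i true  ()  | no _
  matchedAt-InMᵇ c i false eq  | no ¬m = ¬m

  matchedAt-¬InM : ∀ c i → ¬ InM M (c i) (c (suc i)) → matchedAt c i ≡ false
  matchedAt-¬InM c i ¬m with mate M (c i) Fin.≟ c (suc i)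
  ... | yes m = ⊥-elim (¬m m)
  ... | no  _ = refl

module Blossom {n : ℕ} {G : Graph n} (M : PerfectMatching G) (c : ℕ → Fin n) (m : ℕ) (b : Fin n)
  (walk     : IsWalk G c (suc (2 * suc m)))
  (closed   : c (suc (2 * suc m)) ≡ c 0)
  (distinct : ∀ i j → i < j → j ≤ 2 * suc m → c i ≢ c j)
  (countM≡k : countM M c (suc (2 * suc m)) ≡ suc m)
  (j : ℕ) (j≤2k : j ≤ 2 * suc m) (cj≡b : c j ≡ b)
  (mate-b∉c : ¬ OnCycle c (suc m) (mate M b))
  where

  k N : ℕ
  k = suc m
  N = suc (2 * k)

  2k≡2+2m : 2 * k ≡ suc (suc (m + m))
  2k≡2+2m = cong suc (trans (+-suc m (m + 0)) (cong (λ x → suc (m + x)) (+-identityʳ m)))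

  c-injective : ∀ {r r′} → r ≤ 2 * k → r′ ≤ 2 * k → c r ≡ c r′ → r ≡ r′
  c-injective {r} {r′} r≤ r′≤ eq with <-cmp r r′
  ... | tri< r<r′ _ _ = ⊥-elim (distinct r r′ r<r′ r′≤ eq)
  ... | tri≈ _ r≡r′ _ = r≡r′
  ... | tri> _ _ r′<r = ⊥-elim (distinct r′ r r′<r r≤ (sym eq))

  D : ℕ
  D = N ∸ j

  j≤N : j ≤ N
  j≤N = m≤n⇒m≤1+n j≤2k

  j+D≡N : j + D ≡ N
  j+D≡N = m+[n∸m]≡n j≤N

  D+j≡N : D + j ≡ N
  D+j≡N = m∸n+n≡m j≤N

  -- The blossom traversed from its base: c j, c (j + 1), ..., c N = c 0, c 1, ..., c j.
  rotated : ℕ → Fin n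
  rotated = splice (λ t → c (j + t)) D c

  rotated-≤ : ∀ {t} → t ≤ D → rotated t ≡ c (j + t)
  rotated-≤ = splice-≤ (λ t → c (j + t)) D c

  rotated-+ : ∀ i → rotated (D + i) ≡ c i
  rotated-+ = splice-+ (λ t → c (j + t)) D c (trans (cong c j+D≡N) closed)

  rotated-0 : rotated 0 ≡ b
  rotated-0 = trans (rotated-≤ z≤n) (trans (cong c (+-identityʳ j)) cj≡b)

  rotated-N : rotated N ≡ b
  rotated-N = trans (cong rotated (sym D+j≡N)) (trans (rotated-+ j) cj≡b)

  position : ℕ → ℕ
  position t with D ≤? t
  ... | yes _ = t ∸ D
  ... | no  _ = j + t

  rotated-position : ∀ t → rotated t ≡ c (position t)
  rotated-position t with D ≤? t
  ... | yes D≤t = trans (cong rotated (sym (m+[n∸m]≡n D≤t))) (rotated-+ (t ∸ D))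
  ... | no  D≰t = rotated-≤ (<⇒≤ (≰⇒> D≰t))

  position-≤ : ∀ {t} → t ≤ 2 * k → position t ≤ 2 * k
  position-≤ {t} t≤ with D ≤? t
  ... | yes _   = ≤-trans (m∸n≤m t D) t≤
  ... | no  D≰t = ≤-pred (subst (j + t <_) j+D≡N (+-monoʳ-< j (≰⇒> D≰t)))

  tail<j : ∀ {t} → t ≤ 2 * k → D ≤ t → t ∸ D < j
  tail<j {t} t≤ D≤t = subst (t ∸ D <_) (m∸[m∸n]≡n j≤N) (∸-monoˡ-< {t} {D} {N} (s≤s t≤) D≤t)

  position-injective : ∀ {t t′} → t ≤ 2 * k → t′ ≤ 2 * k → position t ≡ position t′ → t ≡ t′
  position-injective {t} {t′} t≤ t′≤ eq with D ≤? t | D ≤? t′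
  ... | yes D≤t | yes D≤t′ = begin
    t            ≡⟨ m+[n∸m]≡n D≤t ⟨
    D + (t ∸ D)  ≡⟨ cong (D +_) eq ⟩
    D + (t′ ∸ D) ≡⟨ m+[n∸m]≡n D≤t′ ⟩
    t′           ∎
    where open ≡-Reasoning
  ... | no  _   | no  _    = +-cancelˡ-≡ j t t′ eq
  ... | yes D≤t | no  _    = ⊥-elim (<⇒≱ (tail<j t≤ D≤t) (subst (j ≤_) (sym eq) (m≤m+n j t′)))
  ... | no  _   | yes D≤t′ = ⊥-elim (<⇒≱ (tail<j t′≤ D≤t′) (subst (j ≤_) eq (m≤m+n j t)))

  rotated-injective : ∀ {t t′} → t ≤ 2 * k → t′ ≤ 2 * k → rotated t ≡ rotated t′ → t ≡ t′
  rotated-injective {t} {t′} t≤ t′≤ eq = position-injective t≤ t′≤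
    (c-injective (position-≤ t≤) (position-≤ t′≤)
      (trans (sym (rotated-position t)) (trans eq (rotated-position t′))))

  rotated-onCycle : ∀ {t} → t ≤ 2 * k → OnCycle c k (rotated t)
  rotated-onCycle {t} t≤ = position t , position-≤ t≤ , sym (rotated-position t)

  rotated-adjacent : ∀ t → t < N → Adj G (rotated t) (rotated (suc t))
  rotated-adjacent t t<N with D ≤? t
  ... | no D≰t = subst₂ (Adj G) (sym (rotated-≤ (<⇒≤ t<D))) (sym (trans (rotated-≤ t<D) (cong c (+-suc j t))))
                   (walk (j + t) (subst (j + t <_) j+D≡N (+-monoʳ-< j t<D)))
    where
    t<D = ≰⇒> D≰t
  ... | yes D≤t with i , refl ← m≤n⇒∃[o]m+o≡n D≤t =
    subst₂ (Adj G) (sym (rotated-+ i)) (sym (trans (cong rotated (sym (+-suc D i))) (rotated-+ (suc i))))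
      (walk i (≤-<-trans (m≤n+m i D) t<N))

  inM : ℕ → Bool
  inM = matchedAt M rotated

  rotated-count : count inM N ≡ count (matchedAt M c) N
  rotated-count = begin
    count inM N                                             ≡⟨ cong (count inM) D+j≡N ⟨
    count inM (D + j)                                       ≡⟨ count-+ inM D j ⟩
    count inM D + count (λ i → inM (D + i)) j                ≡⟨ cong₂ _+_ from-base to-base ⟩
    count (λ i → inMᶜ (j + i)) D + count inMᶜ j                ≡⟨ +-comm _ (count inMᶜ j) ⟩
    count inMᶜ j + count (λ i → inMᶜ (j + i)) D                ≡⟨ count-+ inMᶜ j D ⟨
    count inMᶜ (j + D)                                       ≡⟨ cong (count inMᶜ) j+D≡N ⟩
    count inMᶜ N                                             ∎
    where
    open ≡-Reasoning
    inMᶜ : ℕ → Bool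
    inMᶜ = matchedAt M c
    from-base : count inM D ≡ count (λ i → inMᶜ (j + i)) D
    from-base = count-cong D λ i i<D →
      cong₂ (matched? M) (rotated-≤ (<⇒≤ i<D)) (trans (rotated-≤ i<D) (cong c (+-suc j i)))
    to-base : count (λ i → inM (D + i)) j ≡ count inMᶜ j
    to-base = count-cong j λ i _ →
      cong₂ (matched? M) (rotated-+ i) (trans (cong rotated (sym (+-suc D i))) (rotated-+ (suc i)))

  -- The base is matched outside the blossom, so both edges at it are unmatched.
  inM-first : inM 0 ≡ false
  inM-first = matchedAt-¬InM M rotated 0 λ matched →
    mate-b∉c (subst (OnCycle c k) (sym (trans (cong (mate M) (sym rotated-0)) matched)) (rotated-onCycle (s≤s z≤n)))

  inM-last : inM (2 * k) ≡ false
  inM-last = matchedAt-¬InM M rotated (2 * k) λ matched →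
    mate-b∉c (subst (OnCycle c k) (sym (trans (cong (mate M) (sym rotated-N)) (InM-sym M matched)))
               (rotated-onCycle ≤-refl))

  middle : ℕ → Bool
  middle i = inM (suc i)

  middle-sparse : NoAdjacentTrues middle (suc (m + m))
  middle-sparse i 2+i≤ first = matchedAt-¬InM M rotated (suc (suc i)) λ second →
    <⇒≢ (s≤s (n≤1+n (suc i)))
      (rotated-injective (≤-trans (m≤n+m (suc i) 2) 3+i≤2k) 3+i≤2k
        (trans (sym (InM-sym M (matchedAt-InMᵇ M rotated (suc i) true first))) second))
    where
    3+i≤2k : suc (suc (suc i)) ≤ 2 * k
    3+i≤2k = subst (suc (suc (suc i)) ≤_) (sym 2k≡2+2m) (s≤s 2+i≤)

  middle-count : count middle (suc (m + m)) ≡ suc m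
  middle-count = begin
    count middle (suc (m + m))   ≡⟨ cong (λ x → bit x + 0 + count middle (suc (m + m))) inM-first ⟨
    count inM 1 + count middle (suc (m + m)) ≡⟨ count-+ inM 1 (suc (m + m)) ⟨
    count inM (suc (suc (m + m))) ≡⟨ cong (count inM) 2k≡2+2m ⟨
    count inM (2 * k)             ≡⟨ cong (λ x → bit x + count inM (2 * k)) inM-last ⟨
    count inM N                   ≡⟨ rotated-count ⟩
    count (matchedAt M c) N      ≡⟨ countM≡count M c N ⟨
    countM M c N                 ≡⟨ countM≡k ⟩
    suc m                        ∎
    where open ≡-Reasoning

  inM-alternates : ∀ t → t ≤ 2 * k → inM t ≡ alternate false t
  inM-alternates zero    _  = inM-first
  inM-alternates (suc i) t≤ with i ≤? m + m
  ... | yes i≤2m = trans (sparse-count-max m middle middle-sparse middle-count i i≤2m) (alternate-not false i)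
  ... | no  i≰2m = subst (λ t → inM t ≡ alternate false t) (sym 1+i≡2k)
                     (trans inM-last (sym (alternate-2* false k)))
    where
    1+i≡2k : suc i ≡ 2 * k
    1+i≡2k = trans (cong suc (≤-antisym (≤-pred (subst (suc i ≤_) 2k≡2+2m t≤)) (≰⇒> i≰2m))) (sym 2k≡2+2m)

  loop : AltWalk M b b false true
  loop = record
    { vertex = rotated
    ; length = N
    ; step   = λ t t<N → rotated-adjacent t t<N , matchedAt-InMᵇ M rotated t _ (inM-alternates t (≤-pred t<N))
    ; start  = rotated-0
    ; end    = rotated-N
    ; parity = cong not (alternate-2* false k) }

  locate : ∀ x → OnCycle c k x → Σ ℕ λ t → t ≤ 2 * k × rotated t ≡ x
  locate x (i , i≤2k , refl) with i <? j
  ... | yes i<j = D + i , ≤-pred (subst (D + i <_) D+j≡N (+-monoʳ-< D i<j)) , rotated-+ i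
  ... | no  i≮j = i ∸ j , ≤-trans (m∸n≤m i j) i≤2k ,
                  trans (rotated-≤ (∸-monoˡ-≤ j (m≤n⇒m≤1+n i≤2k))) (cong c (m+[n∸m]≡n (≮⇒≥ i≮j)))

  -- Leave the blossom along whichever of its two arcs starts with a matched edge.
  to-base : ∀ x → OnCycle c k x → AltWalk M x b true true
  to-base x x∈c with locate x x∈c
  ... | t , t≤2k , refl = from (m≤n⇒m≤1+n t≤2k)
    where
    from : t ≤ N → AltWalk M (rotated t) b true true
    from t≤N with alternate false t | drop loop t t≤N | take loop t t≤N
    ... | true  | arc | _   = arc
    ... | false | _   | arc = reverse arc

module _ {n : ℕ} {G : Graph n} {M : PerfectMatching G} {c : ℕ → Fin n} {k : ℕ} {b : Fin n} where

  blossom-loop : IsBlossom M c k → IsBase M c k b → AltWalk M b b false true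
  blossom-loop ((s≤s z≤n , walk , closed , distinct) , countM≡k) ((j , j≤2k , cj≡b) , mate-b∉c) =
    Blossom.loop M c _ b walk closed distinct countM≡k j j≤2k cj≡b mate-b∉c

  blossom-to-base : IsBlossom M c k → IsBase M c k b → ∀ x → OnCycle c k x → AltWalk M x b true true
  blossom-to-base ((s≤s z≤n , walk , closed , distinct) , countM≡k) ((j , j≤2k , cj≡b) , mate-b∉c) =
    Blossom.to-base M c _ b walk closed distinct countM≡k j j≤2k cj≡b mate-b∉c

module _ {n : ℕ} {G : Graph n} {M : PerfectMatching G} (J : Jposy M) where
  open Jposy J hiding (start; end)

  stem : AltWalk M b₁ b₂ true false
  stem = cast (Jposy.start J) (Jposy.end J) refl (mmAltWalk⇒AltWalk walk odd)

  jposy-closedWalk : ∀ {v} → OnJposy J v → AltWalk M v v true false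
  jposy-closedWalk (inj₁ v∈c₁) =
    let P = blossom-to-base blossom₁ base₁ _ v∈c₁ in
    P ++ stem ++ blossom-loop blossom₂ base₂ ++ reverse stem ++ reverse P
  jposy-closedWalk (inj₂ (inj₁ v∈c₂)) =
    let P = blossom-to-base blossom₂ base₂ _ v∈c₂ in
    P ++ reverse stem ++ blossom-loop blossom₁ base₁ ++ stem ++ reverse P
  jposy-closedWalk (inj₂ (inj₂ (i , i≤ℓ , refl))) with alternate true i | take stem i i≤ℓ | drop stem i i≤ℓ
  ... | true  | _      | to-b₂ = to-b₂ ++ blossom-loop blossom₂ base₂ ++ reverse to-b₂
  ... | false | from-b₁ | _    = reverse from-b₁ ++ blossom-loop blossom₁ base₁ ++ from-b₁

-- Changing the matching

module _ {P : ℕ → Set} (P? : Decidable P) where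

  least : ∀ t → P t → ∃ λ s → P s × (∀ {s′} → s′ < s → ¬ P s′)
  least t = <-rec (λ t → P t → ∃ λ s → P s × (∀ {s′} → s′ < s → ¬ P s′)) search t
    where
    search : ∀ t → (∀ {s} → s < t → P s → ∃ λ s → P s × (∀ {s′} → s′ < s → ¬ P s′)) →
             P t → ∃ λ s → P s × (∀ {s′} → s′ < s → ¬ P s′)
    search t earlier Pt with anyUpTo? P? t
    ... | yes (s , s<t , Ps) = earlier s<t Ps
    ... | no  none           = t , Pt , λ s′<t Ps′ → none (_ , s′<t , Ps′)

module _ {n : ℕ} {G : Graph n} {M : PerfectMatching G} where

  ParityInjective : ∀ {x y b e} → AltWalk M x y b e → Set
  ParityInjective {b = b} W =
    ∀ {i j} → i < j → j ≤ length W → alternate b i ≡ alternate b j → vertex W i ≢ vertex W j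

  shortcut : ∀ {x y b e} → AltWalk M x y b e → Σ (AltWalk M x y b e) ParityInjective
  shortcut W = <-rec Shortcut shorten (length W) W refl
    where
    Shortcut : ℕ → Set
    Shortcut l = ∀ {x y b e} (W : AltWalk M x y b e) → length W ≡ l → Σ (AltWalk M x y b e) ParityInjective
    shorten : ∀ l → (∀ {l′} → l′ < l → Shortcut l′) → Shortcut l
    shorten l shorter {b = b} W refl with anyUpTo? repeat? (suc (length W))
      where
      Repeat : ℕ → ℕ → Set
      Repeat i j = alternate b i ≡ alternate b j × vertex W i ≡ vertex W j
      repeat? : ∀ j → Dec (∃ λ i → i < j × Repeat i j)
      repeat? j = anyUpTo? (λ i → (alternate b i Bool.≟ alternate b j) ×-dec (vertex W i Fin.≟ vertex W j)) j
    ... | no  none = W , λ i<j j≤L same-parity same-vertex →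
                           none (_ , s≤s j≤L , _ , i<j , same-parity , same-vertex)
    ... | yes (j , s≤s j≤L , i , i<j , same-parity , same-vertex) =
      shorter (<-≤-trans (+-monoˡ-< (length W ∸ j) i<j) (≤-reflexive (m+[n∸m]≡n j≤L)))
        (cast refl same-vertex same-parity (take W i (<⇒≤ (<-≤-trans i<j j≤L))) ++ drop W j j≤L) refl

-- Given a path p 0, ..., p L whose even-indexed edges are μ-edges, ν is μ with the path
-- switched: it pairs the odd-indexed edges of the path and joins its two ends.
module PathSwitch {A : Set} (_≟_ : DecidableEquality A)
  (μ : A → A) (μ-involutive : ∀ y → μ (μ y) ≡ y)
  (p : ℕ → A) (L : ℕ) (L-odd : alternate true L ≡ false)
  (p-injective : ∀ {i j} → i ≤ L → j ≤ L → p i ≡ p j → i ≡ j)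
  (p-μ : ∀ i → i < L → alternate true i ≡ true → μ (p i) ≡ p (suc i))
  where

  partner : ℕ → ℕ
  partner zero = L
  partner (suc i) with alternate true i | suc i ℕ.≟ L
  ... | true  | yes _ = 0
  ... | true  | no  _ = suc (suc i)
  ... | false | _     = i

  partner-even : ∀ i → alternate true i ≡ false → partner (suc i) ≡ i
  partner-even i i-odd rewrite i-odd = refl

  partner-odd : ∀ {i} → alternate true i ≡ false → i ≢ L → partner i ≡ suc i
  partner-odd {suc i} i-odd i≢L rewrite not-injective i-odd with suc i ℕ.≟ L
  ... | yes i≡L = ⊥-elim (i≢L i≡L)
  ... | no  _   = refl

  partner-L : partner L ≡ 0
  partner-L = at-L L refl L-odd
    where
    at-L : ∀ l → l ≡ L → alternate true l ≡ false → partner l ≡ 0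
    at-L zero    _   ()
    at-L (suc l) l≡L l-odd rewrite not-injective l-odd with suc l ℕ.≟ L
    ... | yes _   = refl
    ... | no  l≢L = ⊥-elim (l≢L l≡L)

  data PartnerView (i : ℕ) : Set where
    first : i ≡ 0 → PartnerView i
    last  : i ≡ L → PartnerView i
    even  : ∀ {i′} → i ≡ suc i′ → alternate true i′ ≡ false → PartnerView i
    odd   : alternate true i ≡ false → i ≢ L → PartnerView i

  partnerView : ∀ i → PartnerView i
  partnerView zero = first refl
  partnerView (suc i) with alternate true i in parity | suc i ℕ.≟ L
  ... | false | _       = even refl parity
  ... | true  | yes i≡L = last i≡L
  ... | true  | no  i≢L = odd (cong not parity) i≢L

  partner-≤ : ∀ {i} → i ≤ L → partner i ≤ L
  partner-≤ {i} i≤L with partnerView i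
  ... | first refl            = ≤-refl
  ... | last  refl            = subst (_≤ L) (sym partner-L) z≤n
  ... | even {i′} refl i′-odd = subst (_≤ L) (sym (partner-even i′ i′-odd)) (≤-trans (n≤1+n _) i≤L)
  ... | odd   i-odd i≢L       = subst (_≤ L) (sym (partner-odd i-odd i≢L)) (≤∧≢⇒< i≤L i≢L)

  partner-alternate : ∀ {i} → i ≤ L → alternate true (partner i) ≡ not (alternate true i)
  partner-alternate {i} i≤L with partnerView i
  ... | first refl            = L-odd
  ... | last  refl            = trans (cong (alternate true) partner-L) (cong not (sym L-odd))
  ... | even {i′} refl i′-odd = trans (cong (alternate true) (partner-even i′ i′-odd)) (sym (not-involutive _))
  ... | odd   i-odd i≢L       = cong (alternate true) (partner-odd i-odd i≢L)

  partner-involutive : ∀ {i} → i ≤ L → partner (partner i) ≡ i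
  partner-involutive {i} i≤L with partnerView i
  ... | first refl            = partner-L
  ... | last  refl            = cong partner partner-L
  ... | even {i′} refl i′-odd = trans (cong partner (partner-even i′ i′-odd)) (partner-odd i′-odd i′≢L)
    where
    i′≢L : i′ ≢ L
    i′≢L i′≡L = 1+n≰n (subst (_≤ L) (cong suc i′≡L) i≤L)
  ... | odd   i-odd i≢L       = trans (cong partner (partner-odd i-odd i≢L)) (partner-even i i-odd)

  OnPath : A → Set
  OnPath y = ∃ λ i → i ≤ L × p i ≡ y

  onPath? : ∀ y → Dec (OnPath y)
  onPath? y = map′ (λ (i , i<1+L , pi≡y) → i , ≤-pred i<1+L , pi≡y)
                   (λ (i , i≤L , pi≡y) → i , s≤s i≤L , pi≡y)
                   (anyUpTo? (λ i → p i ≟ y) (suc L))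

  μ-onPath : ∀ {i} → i ≤ L → OnPath (μ (p i))
  μ-onPath {i} i≤L with alternate true i in parity
  ... | true  = suc i , i<L , sym (p-μ i i<L parity)
    where
    i<L : i < L
    i<L = ≤∧≢⇒< i≤L λ { refl → case trans (sym parity) L-odd of λ () }
  μ-onPath {suc i} i≤L | false =
    i , ≤-trans (n≤1+n i) i≤L , trans (sym (μ-involutive (p i))) (cong μ (p-μ i i≤L (not-injective parity)))

  μ-offPath : ∀ {y} → ¬ OnPath y → ¬ OnPath (μ y)
  μ-offPath {y} off (i , i≤L , pi≡μy) with μ-onPath i≤L
  ... | j , j≤L , pj≡μpi = off (j , j≤L , trans pj≡μpi (trans (cong μ pi≡μy) (μ-involutive y)))

  ν : A → A
  ν y with onPath? y
  ... | yes (i , _ , _) = p (partner i)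
  ... | no  _           = μ y

  ν-onPath : ∀ {i} → i ≤ L → ν (p i) ≡ p (partner i)
  ν-onPath {i} i≤L with onPath? (p i)
  ... | yes (j , j≤L , pj≡pi) = cong (λ j → p (partner j)) (p-injective j≤L i≤L pj≡pi)
  ... | no  off               = ⊥-elim (off (i , i≤L , refl))

  ν-offPath : ∀ {y} → ¬ OnPath y → ν y ≡ μ y
  ν-offPath {y} off with onPath? y
  ... | yes on = ⊥-elim (off on)
  ... | no  _  = refl

  ν-involutive : ∀ y → ν (ν y) ≡ y
  ν-involutive y with onPath? y
  ... | yes (i , i≤L , refl) = trans (ν-onPath (partner-≤ i≤L)) (cong p (partner-involutive i≤L))
  ... | no  off              = trans (ν-offPath (μ-offPath off)) (μ-involutive y)

involutive⇒injective : {A : Set} (f : A → A) → (∀ y → f (f y) ≡ y) → ∀ {x y} → f x ≡ f y → x ≡ y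
involutive⇒injective f f-involutive {x} {y} fx≡fy =
  trans (sym (f-involutive x)) (trans (cong f fx≡fy) (f-involutive y))

-- Alternately applying two involutions of a finite set starting from a, one must reach ν a
-- through a μ-step; s is the first time this happens.
module Orbit {A : Set} (_≟_ : DecidableEquality A) {N : ℕ} (encode : A → Fin N)
  (encode-injective : ∀ {x y} → encode x ≡ encode y → x ≡ y)
  (μ ν : A → A) (μ-involutive : ∀ y → μ (μ y) ≡ y) (ν-involutive : ∀ y → ν (ν y) ≡ y) (a : A)
  where

  orbit : ℕ → A
  orbit zero    = a
  orbit (suc h) = ν (μ (orbit h))

  orbit-cancel : ∀ i d → orbit (i + d) ≡ orbit i → orbit d ≡ a
  orbit-cancel zero    d eq = eq
  orbit-cancel (suc i) d eq =
    orbit-cancel i d (involutive⇒injective μ μ-involutive (involutive⇒injective ν ν-involutive eq))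

  orbit-returns : ∃ λ t → orbit (suc t) ≡ a
  orbit-returns =
    let i , j , i<j , same = Fin.pigeonhole (n<1+n N) (λ i → encode (orbit (Fin.toℕ i)))
        d , 1+i+d≡j       = m≤n⇒∃[o]m+o≡n i<j
    in d , orbit-cancel (Fin.toℕ i) (suc d)
             (trans (cong orbit (trans (+-suc (Fin.toℕ i) d) 1+i+d≡j))
                    (sym (encode-injective {orbit (Fin.toℕ i)} {orbit (Fin.toℕ j)} same)))

  μ-step-to-νa : ∀ t → orbit (suc t) ≡ a → μ (orbit t) ≡ ν a
  μ-step-to-νa _ returns = trans (sym (ν-involutive _)) (cong ν returns)

  exit : ∃ λ s → μ (orbit s) ≡ ν a × (∀ {h} → h < s → μ (orbit h) ≢ ν a)
  exit = let t , returns = orbit-returns in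
         least {P = λ h → μ (orbit h) ≡ ν a} (λ h → μ (orbit h) ≟ ν a) t (μ-step-to-νa t returns)

  s : ℕ
  s = proj₁ exit

  orbit-exits : μ (orbit s) ≡ ν a
  orbit-exits = proj₁ (proj₂ exit)

  orbit-stays : ∀ {h} → h < s → μ (orbit h) ≢ ν a
  orbit-stays = proj₂ (proj₂ exit)

  orbit-moves : ∀ {h} → h < s → orbit (suc h) ≢ orbit h
  orbit-moves {h} h<s eq =
    orbit-stays (≤-<-trans z≤n h<s) (μ-step-to-νa 0 (orbit-cancel h 1 (trans (cong orbit (+-comm h 1)) eq)))

-- The bipartite double cover: the Bool records the parity of a position on a walk.
Lifted : ℕ → Set
Lifted n = Fin n × Bool

module _ {n : ℕ} where

  _≟ˡ_ : DecidableEquality (Lifted n)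
  _≟ˡ_ = ≡-dec Fin._≟_ Bool._≟_

  toSum : Lifted n → Fin n ⊎ Fin n
  toSum (x , true)  = inj₁ x
  toSum (x , false) = inj₂ x

  toSum-injective : ∀ {y z} → toSum y ≡ toSum z → y ≡ z
  toSum-injective {_ , true}  {_ , true}  refl = refl
  toSum-injective {_ , false} {_ , false} refl = refl
  toSum-injective {_ , true}  {_ , false} ()
  toSum-injective {_ , false} {_ , true}  ()

  encode : Lifted n → Fin (n + n)
  encode y = Fin.join n n (toSum y)

  encode-injective : ∀ {y z} → encode y ≡ encode z → y ≡ z
  encode-injective {y} {z} eq = toSum-injective
    (trans (sym (Fin.splitAt-join n n (toSum y))) (trans (cong (Fin.splitAt n) eq) (Fin.splitAt-join n n (toSum z))))

  lift : {G : Graph n} → PerfectMatching G → Lifted n → Lifted n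
  lift M (x , s) = mate M x , not s

  lift-involutive : {G : Graph n} (M : PerfectMatching G) → ∀ y → lift M (lift M y) ≡ y
  lift-involutive M (x , s) = cong₂ _,_ (mate-invol M x) (not-involutive s)

module Transfer {n : ℕ} {G : Graph n} (M M′ : PerfectMatching G) {v : Fin n}
  (P : AltWalk M′ v v true false) (P-injective : ParityInjective P) where

  L : ℕ
  L = length P

  path : ℕ → Lifted n
  path i = vertex P i , alternate true i

  path-injective : ∀ {i j} → i ≤ L → j ≤ L → path i ≡ path j → i ≡ j
  path-injective {i} {j} i≤L j≤L eq with <-cmp i j
  ... | tri< i<j _ _ = ⊥-elim (P-injective i<j j≤L (cong proj₂ eq) (cong proj₁ eq))
  ... | tri≈ _ i≡j _ = i≡j
  ... | tri> _ _ j<i = ⊥-elim (P-injective j<i i≤L (cong proj₂ (sym eq)) (cong proj₁ (sym eq)))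

  path-matched : ∀ i → i < L → alternate true i ≡ true → lift M′ (path i) ≡ path (suc i)
  path-matched i i<L i-even = cong (_, alternate true (suc i))
    (subst (λ c → InMᵇ M′ c (vertex P i) (vertex P (suc i))) i-even (proj₂ (step P i i<L)))

  open PathSwitch _≟ˡ_ (lift M′) (lift-involutive M′) path L (parity P) path-injective path-matched

  ν-flips : ∀ y → proj₂ (ν y) ≡ not (proj₂ y)
  ν-flips y with onPath? y
  ... | yes (i , i≤L , refl) = partner-alternate i≤L
  ... | no  _                = refl

  partner-adjacent : ∀ {i} → i ≤ L → i ≢ 0 → i ≢ L → Adj G (vertex P i) (vertex P (partner i))
  partner-adjacent {i} i≤L i≢0 i≢L with partnerView i
  ... | first i≡0             = ⊥-elim (i≢0 i≡0)
  ... | last  i≡L             = ⊥-elim (i≢L i≡L)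
  ... | even {i′} refl i′-odd = subst (λ j → Adj G (vertex P i) (vertex P j)) (sym (partner-even i′ i′-odd))
                                  (Graph.sym G (proj₁ (step P i′ i≤L)))
  ... | odd   i-odd _         = subst (λ j → Adj G (vertex P i) (vertex P j)) (sym (partner-odd i-odd i≢L))
                                  (proj₁ (step P i (≤∧≢⇒< i≤L i≢L)))

  ν-adjacent : ∀ y → y ≢ path 0 → y ≢ path L → Adj G (proj₁ y) (proj₁ (ν y))
  ν-adjacent y y≢first y≢last with onPath? y
  ... | yes (i , i≤L , refl) = partner-adjacent i≤L (λ { refl → y≢first refl }) (λ { refl → y≢last refl })
  ... | no  _                = mate-adj M′ (proj₁ y)

  open Orbit _≟ˡ_ encode encode-injective (lift M) ν (lift-involutive M) ν-involutive (path 0)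

  orbit-parity : ∀ h → proj₂ (orbit h) ≡ true
  orbit-parity zero    = refl
  orbit-parity (suc h) = trans (ν-flips _) (cong (λ b → not (not b)) (orbit-parity h))

  matched-step : ∀ x → Step M true x (mate M x)
  matched-step x = mate-adj M x , refl

  unmatched-step : ∀ {h} → h < s → Step M false (mate M (proj₁ (orbit h))) (proj₁ (orbit (suc h)))
  unmatched-step {h} h<s = ν-adjacent y y≢first y≢last , unmatched
    where
    y = lift M (orbit h)
    y≢first : y ≢ path 0
    y≢first eq = case trans (sym (cong not (orbit-parity h))) (cong proj₂ eq) of λ ()
    y≢last : y ≢ path L
    y≢last eq = orbit-stays h<s (trans eq (sym (ν-onPath z≤n)))
    unmatched : ¬ InM M (proj₁ y) (proj₁ (ν y))
    unmatched matched = orbit-moves h<s (sym (begin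
      orbit h            ≡⟨ lift-involutive M (orbit h) ⟨
      lift M y           ≡⟨ cong₂ _,_ matched (sym (ν-flips y)) ⟩
      ν y                ∎))
      where open ≡-Reasoning

  zigzag : ∀ h → h ≤ s → AltWalk M (vertex P 0) (mate M (proj₁ (orbit h))) true false
  zigzag zero    _      = edge (matched-step _)
  zigzag (suc h) 1+h≤s = zigzag h (<⇒≤ 1+h≤s) ++ edge (unmatched-step 1+h≤s) ++ edge (matched-step _)

  closedWalk : AltWalk M v v true false
  closedWalk = cast (start P) (trans (cong proj₁ (trans orbit-exits (ν-onPath z≤n))) (end P)) refl (zigzag s ≤-refl)

transfer : ∀ {n} {G : Graph n} (M M′ : PerfectMatching G) {v} →
           AltWalk M′ v v true false → AltWalk M v v true false
transfer M M′ W = let P , P-injective = shortcut W in Transfer.closedWalk M M′ P P-injective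

mainTheorem3 : ∀ {n : ℕ} (G : Graph n) (M : PerfectMatching G) (v : Fin n) →
    InVSD G v →
    Σ (ℕ → Fin n) λ w → ∃[ k ] (IsMMAltWalk M w k × w 0 ≡ v × w k ≡ v)
mainTheorem3 G M v (M′ , J , v∈J) = AltWalk⇒mmAltWalk (transfer M M′ (jposy-closedWalk J v∈J))
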